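{- Let $A$ be a set and let $\mathrel{\vdash\!\dashv}$, $\to$, $\leadsto$ be binary relations on $A$ such that $\mathrel{\vdash\!\dashv}$ is symmetric, ${\leadsto} \subseteq {\mathrel{\vdash\!\dashv}}$, and the relation ${\to} \circ {\stackrel{*}{\leadsto}}$ is well-founded. Let ${\Rightarrow} = {\leadsto} \cup {\to}$. Suppose (i) ${\gets} \circ {\to} \subseteq {\stackrel{*}{\Rightarrow}} \circ {\stackrel{=}{\vdash\!\dashv}} \circ {\stackrel{*}{\Leftarrow}}$, and (ii) ${\mathrel{\vdash\!\dashv}} \circ {\to} \subseteq ({\stackrel{=}{\vdash\!\dashv}} \circ {\stackrel{*}{\Leftarrow}}) \cup ({\to} \circ {\stackrel{*}{\Rightarrow}} \circ {\stackrel{=}{\vdash\!\dashv}} \circ {\stackrel{*}{\Leftarrow}})$. Then $\to$ is Church-Rosser modulo $\stackrel{*}{\vdash\!\dashv}$.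
   Context: For a relation $R$ on $A$: $R^{ -1}$ (written with a reversed arrow, e.g. $\gets$, $\Leftarrow$) is its inverse; $\stackrel{=}{R}$ its reflexive closure; $\stackrel{+}{R}$ its transitive closure; $\stackrel{*}{R}$ its reflexive-transitive closure. Composition: $a \,(R\circ S)\, c$ iff there is $b$ with $a\,R\,b$ and $b\,S\,c$. For relations $R,S$, $R\subseteq S$ means $a\,R\,b$ implies $a\,S\,b$. A relation $R$ is well-founded if there is no infinite chain $a_0\,R\,a_1\,R\,a_2\cdots$. Given an equivalence relation $\sim$ on $A$, a relation $\to$ is Church-Rosser modulo $\sim$ if $\stackrel{*}{\bowtie} \subseteq \stackrel{*}{\to}\circ \sim \circ \stackrel{*}{\gets}$, where ${\bowtie} = {\leftrightarrow} \cup {\sim}$ and $\leftrightarrow$ is the symmetric closure of $\to$. Note that $\stackrel{*}{\vdash\!\dashv}$ (reflexive-transitive closure of the symmetric relation $\mathrel{\vdash\!\dashv}$) is an equivalence relation. -}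

module Defs where

open import Level using (Level; _⊔_)
open import Function using (flip)
open import Data.Product using (∃; _×_; _,_)
open import Data.Sum using (_⊎_)
open import Relation.Binary.Core using (Rel; _⇒_)
open import Relation.Binary.Construct.Closure.ReflexiveTransitive using (Star)
open import Relation.Binary.Construct.Closure.Reflexive using (ReflClosure)
open import Induction.WellFounded using (WellFounded)

private variable a ℓ : Level

_⨾_ : {A : Set a} → Rel A ℓ → Rel A ℓ → Rel A (a ⊔ ℓ)
(R ⨾ S) x z = ∃ λ y → R x y × S y z
infixr 9 _⨾_

_∪_ : {A : Set a} → Rel A ℓ → Rel A ℓ → Rel A ℓ
(R ∪ S) x y = R x y ⊎ S x y
infixr 7 _∪_

_⁻¹ : {A : Set a} → Rel A ℓ → Rel A ℓ
R ⁻¹ = flip R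

-- "R is well-founded": no infinite chain a₀ R a₁ R a₂ ⋯ (constructively: every
-- element is accessible when stepping along R, i.e. stdlib WellFounded of R⁻¹)
WF : {A : Set a} → Rel A ℓ → Set (a ⊔ ℓ)
WF R = WellFounded (R ⁻¹)

SymCl : {A : Set a} → Rel A ℓ → Rel A ℓ
SymCl R = R ∪ (R ⁻¹)

ChurchRosserModulo : {A : Set a} → Rel A a → Rel A a → Set a
ChurchRosserModulo _∼_ _⟶_ =
  Star (SymCl _⟶_ ∪ _∼_) ⇒ (Star _⟶_ ⨾ _∼_ ⨾ (Star _⟶_ ⁻¹))

module Submission where

-- The proof is the classical proof-ordering argument.  A conversion is a chain of
-- steps  →,  ←  and  ⊣⊢ ; its WEIGHT is a list of elements: a → or ← step counts its
-- upper end, a ⊣⊢ step counts both ends twice.  Elements are compared by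
-- y ≺ x  iff  x (→ ∘ ⇝*)⁺ y, which is well-founded by hypothesis, and weights by the
-- multiset extension of ≺, which is again well-founded.
--
-- So every conversion
--    that is not a valley can be made smaller, and well-founded induction on weights
--    turns every conversion into a valley, which is the Church–Rosser property.

open import Defs
open import Level using (Level; _⊔_)
open import Data.Product using (∃; Σ; _×_; _,_)
open import Data.Sum using (_⊎_; inj₁; inj₂)
open import Data.List using (List; []; _∷_; _++_)
open import Data.List.Relation.Unary.All using (All; []; _∷_)
open import Relation.Binary.Core using (Rel; _⇒_)
open import Relation.Binary.Definitions using (Symmetric)
open import Relation.Binary.Construct.Closure.ReflexiveTransitive using (Star; ε; _◅_; _◅◅_; gmap)
open import Relation.Binary.Construct.Closure.Reflexive using (ReflClosure; refl; [_])
open import Relation.Binary.Construct.Closure.Reflexive.Properties using (sym)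
open import Relation.Binary.Construct.Closure.Transitive as Transitive using (TransClosure; [_]; _∷_)
open import Induction.WellFounded using (Acc; acc; WellFounded; module Subrelation)

star-then : ∀ {a ℓ} {A : Set a} {R : Rel A ℓ} {x y z} → Star R x y → R y z → TransClosure R x z
star-then ε r = [ r ]
star-then (s ◅ ss) r = s ∷ star-then ss r

module MultisetExtension {a ℓ} {A : Set a} (_<_ : Rel A ℓ) where

  data _⊲_ : Rel (List A) (a ⊔ ℓ) where
    here  : ∀ {x K L} → All (_< x) K → (K ++ L) ⊲ (x ∷ L)
    there : ∀ {x N M} → N ⊲ M → (x ∷ N) ⊲ (x ∷ M)

  -- Well-foundedness of ⊲ (Nipkow's argument): by induction on the accessibility of
  -- the head, x ∷ M is accessible whenever M is.
  private
    ConsAcc : A → Set _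
    ConsAcc x = ∀ {y} → y < x → ∀ {N} → Acc _⊲_ N → Acc _⊲_ (y ∷ N)

    ++-acc : ∀ {x K M} → ConsAcc x → All (_< x) K → Acc _⊲_ M → Acc _⊲_ (K ++ M)
    ++-acc below [] accM = accM
    ++-acc below (y<x ∷ K<x) accM = below y<x (++-acc below K<x accM)

    ∷-acc′ : ∀ {x} → ConsAcc x → ∀ {M} → Acc _⊲_ M → Acc _⊲_ (x ∷ M)
    ∷-acc′ below (acc rs) = acc λ where
      (here K<x)  → ++-acc below K<x (acc rs)
      (there N⊲M) → ∷-acc′ below (rs N⊲M)

    ∷-acc : ∀ {x} → Acc _<_ x → ∀ {M} → Acc _⊲_ M → Acc _⊲_ (x ∷ M)
    ∷-acc (acc rs) = ∷-acc′ (λ y<x → ∷-acc (rs y<x))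

  ⊲-wellFounded : WellFounded _<_ → WellFounded _⊲_
  ⊲-wellFounded wf [] = acc λ ()
  ⊲-wellFounded wf (x ∷ L) = ∷-acc (wf x) (⊲-wellFounded wf L)

  -- Dom N M: N arises from M by keeping or replacing each
  -- element; Abs x N M: a prefix of N lies below x (x is being replaced) and the
  -- rest is dominated by M; N ⋖ M: as Dom, but at least one element is replaced.
  data Dom : Rel (List A) (a ⊔ ℓ)
  data Abs (x : A) : Rel (List A) (a ⊔ ℓ)

  data Dom where
    done    : ∀ {N} → Dom N N
    keep    : ∀ {x N M} → Dom N M → Dom (x ∷ N) (x ∷ M)
    replace : ∀ {x N M} → Abs x N M → Dom N (x ∷ M)

  data Abs x where
    close  : ∀ {N M} → Dom N M → Abs x N M
    absorb : ∀ {y N M} → y < x → Abs x N M → Abs x (y ∷ N) M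

  data _⋖_ : Rel (List A) (a ⊔ ℓ) where
    keep    : ∀ {x N M} → N ⋖ M → (x ∷ N) ⋖ (x ∷ M)
    replace : ∀ {x N M} → Abs x N M → N ⋖ (x ∷ M)

  delete : ∀ P {N M} → Dom N M → Dom N (P ++ M)
  delete [] d = d
  delete (x ∷ P) d = replace (close (delete P d))

  ++-keep : ∀ K {N M} → N ⋖ M → (K ++ N) ⋖ (K ++ M)
  ++-keep [] lt = lt
  ++-keep (x ∷ K) lt = keep (++-keep K lt)

  Dom⇒⊲* : ∀ {N M} → Dom N M → Star _⊲_ N M
  Abs-split : ∀ {x N M} → Abs x N M → ∃ λ K → All (_< x) K × Star _⊲_ N (K ++ M)

  Dom⇒⊲* done = ε
  Dom⇒⊲* (keep d) = gmap _ there (Dom⇒⊲* d)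
  Dom⇒⊲* (replace ab) with Abs-split ab
  ... | _ , K<x , steps = steps ◅◅ (here K<x ◅ ε)

  Abs-split (close d) = [] , [] , Dom⇒⊲* d
  Abs-split (absorb y<x ab) with Abs-split ab
  ... | K , K<x , steps = _ ∷ K , y<x ∷ K<x , gmap _ there steps

  ⋖-split : ∀ {N M} → N ⋖ M → ∃ λ N′ → Star _⊲_ N N′ × N′ ⊲ M
  ⋖-split (keep lt) with ⋖-split lt
  ... | _ , steps , last = _ , gmap _ there steps , there last
  ⋖-split (replace ab) with Abs-split ab
  ... | K , K<x , steps = _ , steps , here K<x

  ⋖⇒⊲⁺ : ∀ {N M} → N ⋖ M → TransClosure _⊲_ N M
  ⋖⇒⊲⁺ lt with ⋖-split lt
  ... | _ , steps , last = star-then steps last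

  ⋖-wellFounded : WellFounded _<_ → WellFounded _⋖_
  ⋖-wellFounded wf L = Subrelation.accessible ⋖⇒⊲⁺ (Transitive.accessible _⊲_ (⊲-wellFounded wf L))

module Conversions {a} {A : Set a} (_⊣⊢_ _⟶_ : Rel A a) where

  data Step (x y : A) : Set a where
    fw : x ⟶ y → Step x y
    bw : y ⟶ x → Step x y
    eq : x ⊣⊢ y → Step x y

  Conversion : Rel A a
  Conversion = Star Step

  -- The weight counts the upper end of an arrow, and both ends of ⊣⊢ twice: the
  -- doubling lets one copy of an end survive as the source of a new → step while
  -- the other copy pays for the elements below it (see `cliff`).
  stepWeight : ∀ {x y} → Step x y → List A
  stepWeight {x}     (fw _) = x ∷ []
  stepWeight {y = y} (bw _) = y ∷ []
  stepWeight {x} {y} (eq _) = x ∷ x ∷ y ∷ y ∷ []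

  weight : ∀ {x y} → Conversion x y → List A
  weight ε = []
  weight (s ◅ c) = stepWeight s ++ weight c

  data Descent : ∀ {x y} → Conversion x y → Set a where
    bottom : ∀ {x} → Descent (ε {x = x})
    down   : ∀ {x y z} {p : y ⟶ x} {c : Conversion y z} → Descent c → Descent (bw p ◅ c)

  data Plateau : ∀ {x y} → Conversion x y → Set a where
    across  : ∀ {x y z} {e : x ⊣⊢ y} {c : Conversion y z} → Plateau c → Plateau (eq e ◅ c)
    descent : ∀ {x y} {c : Conversion x y} → Descent c → Plateau c

  data Valley : ∀ {x y} → Conversion x y → Set a where
    up      : ∀ {x y z} {p : x ⟶ y} {c : Conversion y z} → Valley c → Valley (fw p ◅ c)
    plateau : ∀ {x y} {c : Conversion x y} → Plateau c → Valley c

  descent⇒ : ∀ {x y} {c : Conversion x y} → Descent c → (Star _⟶_ ⁻¹) x y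
  descent⇒ bottom = ε
  descent⇒ (down {p = p} d) = descent⇒ d ◅◅ (p ◅ ε)

  plateau⇒ : ∀ {x y} {c : Conversion x y} → Plateau c → (Star _⊣⊢_ ⨾ (Star _⟶_ ⁻¹)) x y
  plateau⇒ (across {e = e} pl) with plateau⇒ pl
  ... | _ , es , ps = _ , e ◅ es , ps
  plateau⇒ (descent d) = _ , ε , descent⇒ d

  valley⇒ : ∀ {x y} {c : Conversion x y} → Valley c → (Star _⟶_ ⨾ Star _⊣⊢_ ⨾ (Star _⟶_ ⁻¹)) x y
  valley⇒ (up {p = p} v) with valley⇒ v
  ... | _ , ps , rest = _ , p ◅ ps , rest
  valley⇒ (plateau pl) = _ , ε , plateau⇒ pl

  toConversion : Star (SymCl _⟶_ ∪ Star _⊣⊢_) ⇒ Conversion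
  toConversion ε = ε
  toConversion (inj₁ (inj₁ p) ◅ r) = fw p ◅ toConversion r
  toConversion (inj₁ (inj₂ p) ◅ r) = bw p ◅ toConversion r
  toConversion (inj₂ es ◅ r) = gmap _ eq es ◅◅ toConversion r

module Confluence {a} {A : Set a} (_⊣⊢_ _⟶_ _⇝_ : Rel A a)
  (⊣⊢-sym : Symmetric _⊣⊢_) (⇝⊆⊣⊢ : _⇝_ ⇒ _⊣⊢_) (wf : WF (_⟶_ ⨾ Star _⇝_)) where

  open Conversions _⊣⊢_ _⟶_

  _⇛_ : Rel A a
  _⇛_ = _⇝_ ∪ _⟶_

  _⇓_ : Rel A a
  _⇓_ = Star _⇛_ ⨾ ReflClosure _⊣⊢_ ⨾ (Star _⇛_ ⁻¹)

  ⇓-sym : Symmetric _⇓_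
  ⇓-sym (m , π₁ , n , r , π₂) = n , π₂ , m , sym ⊣⊢-sym r , π₁

  _≺_ : Rel A a
  _≺_ = TransClosure ((_⟶_ ⨾ Star _⇝_) ⁻¹)

  ≺-wellFounded : WellFounded _≺_
  ≺-wellFounded = Transitive.wellFounded _ wf

  top : ∀ {x y} → x ⟶ y → y ≺ x
  top p = [ _ , p , ε ]

  -- The region below x is closed under ⇛; for ⇝ this is where the ⇝* in the
  -- well-foundedness hypothesis is used.
  ≺-⇛ : ∀ {x u v} → u ≺ x → u ⇛ v → v ≺ x
  ≺-⇛ u≺x (inj₂ p) = (_ , p , ε) ∷ u≺x
  ≺-⇛ [ k , p , qs ] (inj₁ q) = [ k , p , qs ◅◅ (q ◅ ε) ]
  ≺-⇛ ((k , p , qs) ∷ u≺x) (inj₁ q) = (k , p , qs ◅◅ (q ◅ ε)) ∷ u≺x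

  ≺-⇛* : ∀ {x u v} → u ≺ x → Star _⇛_ u v → v ≺ x
  ≺-⇛* u≺x ε = u≺x
  ≺-⇛* u≺x (s ◅ π) = ≺-⇛* (≺-⇛ u≺x s) π

  open MultisetExtension _≺_

  forward : ∀ {u v w} → Star _⇛_ u v → Conversion v w → Conversion u w
  forward ε d = d
  forward (inj₁ q ◅ π) d = eq (⇝⊆⊣⊢ q) ◅ forward π d
  forward (inj₂ p ◅ π) d = fw p ◅ forward π d

  backward : ∀ {u v w} → Star _⇛_ u v → Conversion u w → Conversion v w
  backward ε d = d
  backward (inj₁ q ◅ π) d = backward π (eq (⊣⊢-sym (⇝⊆⊣⊢ q)) ◅ d)
  backward (inj₂ p ◅ π) d = backward π (bw p ◅ d)

  cross : ∀ {u v w} → ReflClosure _⊣⊢_ u v → Conversion v w → Conversion u w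
  cross refl d = d
  cross [ e ] d = eq e ◅ d

  join : ∀ {u v w} → u ⇓ v → Conversion v w → Conversion u w
  join (_ , π₁ , _ , r , π₂) d = forward π₁ (cross r (backward π₂ d))

  forward-below : ∀ {x u v w M} → u ≺ x → (π : Star _⇛_ u v) (d : Conversion v w) →
    Abs x (weight d) M → Abs x (weight (forward π d)) M
  forward-below u≺x ε d ab = ab
  forward-below u≺x (inj₁ q ◅ π) d ab =
    absorb u≺x (absorb u≺x (absorb v≺x (absorb v≺x (forward-below v≺x π d ab))))
    where v≺x = ≺-⇛ u≺x (inj₁ q)
  forward-below u≺x (inj₂ p ◅ π) d ab = absorb u≺x (forward-below (≺-⇛ u≺x (inj₂ p)) π d ab)

  backward-below : ∀ {x u v w M} → u ≺ x → (π : Star _⇛_ u v) (d : Conversion u w) →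
    Abs x (weight d) M → Abs x (weight (backward π d)) M
  backward-below u≺x ε d ab = ab
  backward-below u≺x (inj₁ q ◅ π) d ab =
    backward-below v≺x π _ (absorb v≺x (absorb v≺x (absorb u≺x (absorb u≺x ab))))
    where v≺x = ≺-⇛ u≺x (inj₁ q)
  backward-below u≺x (inj₂ p ◅ π) d ab = backward-below (≺-⇛ u≺x (inj₂ p)) π _ (absorb u≺x ab)

  cross-below : ∀ {x y m n w M} → m ≺ x → n ≺ y →
    (r : ReflClosure _⊣⊢_ m n) (d : Conversion n w) → ∀ P →
    Abs y (weight d) M → Abs x (weight (cross r d)) (P ++ y ∷ M)
  cross-below _ _ refl d P ab = close (delete P (replace ab))
  cross-below m≺x n≺y [ e ] d P ab =
    absorb m≺x (absorb m≺x (close (delete P (replace (absorb n≺y (absorb n≺y ab))))))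

  join-below : ∀ {x y u v w M} → u ≺ x → v ≺ y → (j : u ⇓ v) (d : Conversion v w) → ∀ P →
    Abs y (weight d) M → Abs x (weight (join j d)) (P ++ y ∷ M)
  join-below u≺x v≺y (_ , π₁ , _ , r , π₂) d P ab =
    forward-below u≺x π₁ _
      (cross-below (≺-⇛* u≺x π₁) (≺-⇛* v≺y π₂) r _ P (backward-below v≺y π₂ d ab))

  Reducible : ∀ {x y} → Conversion x y → Set a
  Reducible {x} {y} c = ∃ λ (c′ : Conversion x y) → weight c′ ⋖ weight c

  module _
    (peaks : ((_⟶_ ⁻¹) ⨾ _⟶_) ⇒ _⇓_)
    (cliffs : (_⊣⊢_ ⨾ _⟶_) ⇒ ((ReflClosure _⊣⊢_ ⨾ (Star _⇛_ ⁻¹)) ∪ (_⟶_ ⨾ _⇓_))) where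

    peak : ∀ {u v w z} (p : v ⟶ u) (q : v ⟶ w) (d : Conversion w z) → Reducible (bw p ◅ fw q ◅ d)
    peak p q d = join j d , replace (join-below (top p) (top q) j d [] (close done))
      where j = peaks (_ , p , q)

    cliff : ∀ {x y z w} (e : x ⊣⊢ y) (p : y ⟶ z) (d : Conversion z w) → Reducible (eq e ◅ fw p ◅ d)
    cliff {x} {y} e p d with cliffs (_ , e , p)
    ... | inj₁ (_ , refl , π) =
      backward π d ,
      replace (close (delete (x ∷ [])
        (replace (backward-below (top p) π d (close (delete (y ∷ y ∷ []) done))))))
    ... | inj₁ (_ , [ r ] , π) =
      eq r ◅ backward π d ,
      keep (keep (replace (absorb w≺y (absorb w≺y
        (backward-below (top p) π d (close (delete (y ∷ y ∷ []) done)))))))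
      where w≺y = ≺-⇛* (top p) π
    ... | inj₂ (_ , p₀ , j) =
      fw p₀ ◅ join j d ,
      keep (replace (join-below (top p₀) (top p) j d [] (close (delete (y ∷ y ∷ []) done))))

    cliff′ : ∀ {u v s w} (p : v ⟶ u) (e : v ⊣⊢ s) (d : Conversion s w) → Reducible (bw p ◅ eq e ◅ d)
    cliff′ {v = v} {s} p e d with cliffs (_ , ⊣⊢-sym e , p)
    ... | inj₁ (_ , refl , π) =
      forward π d ,
      replace (forward-below (top p) π d (close (delete (v ∷ v ∷ s ∷ s ∷ []) done)))
    ... | inj₁ (_ , [ r ] , π) =
      forward π (eq (⊣⊢-sym r) ◅ d) ,
      replace (forward-below (top p) π _
        (absorb w≺v (absorb w≺v (close (delete (v ∷ v ∷ []) done)))))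
      where w≺v = ≺-⇛* (top p) π
    ... | inj₂ (_ , p₀ , j) =
      join (⇓-sym j) (bw p₀ ◅ d) ,
      replace (join-below (top p) (top p₀) (⇓-sym j) (bw p₀ ◅ d) (v ∷ v ∷ []) (close done))

    extend : ∀ {x y z} (s : Step x y) {c : Conversion y z} → Valley c → Valley (s ◅ c) ⊎ Reducible (s ◅ c)
    extend (fw p) v = inj₁ (up v)
    extend (eq e) (up {p = p} {c = c} _) = inj₂ (cliff e p c)
    extend (eq e) (plateau pl) = inj₁ (plateau (across pl))
    extend (bw p) (up {p = q} {c = c} _) = inj₂ (peak p q c)
    extend (bw p) (plateau (across {e = e} {c = c} _)) = inj₂ (cliff′ p e c)
    extend (bw p) (plateau (descent d)) = inj₁ (plateau (descent (down d)))

    progress : ∀ {x y} (c : Conversion x y) → Valley c ⊎ Reducible c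
    progress ε = inj₁ (plateau (descent bottom))
    progress (s ◅ c) with progress c
    ... | inj₁ v = extend s v
    ... | inj₂ (c′ , c′⋖c) = inj₂ (s ◅ c′ , ++-keep (stepWeight s) c′⋖c)

    normalise : ∀ {x y} (c : Conversion x y) → Acc _⋖_ (weight c) → Σ (Conversion x y) Valley
    normalise c (acc smaller) with progress c
    ... | inj₁ v = c , v
    ... | inj₂ (c′ , c′⋖c) = normalise c′ (smaller c′⋖c)

    church-rosser : ChurchRosserModulo (Star _⊣⊢_) _⟶_
    church-rosser conv with normalise (toConversion conv) (⋖-wellFounded ≺-wellFounded _)
    ... | _ , v = valley⇒ v

theorem2p2 : {a : Level} {A : Set a} (_⊣⊢_ _⟶_ _⇝_ : Rel A a) →
    Symmetric _⊣⊢_ →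
    _⇝_ ⇒ _⊣⊢_ →
    WF (_⟶_ ⨾ Star _⇝_) →
    ((_⟶_ ⁻¹) ⨾ _⟶_) ⇒ (Star (_⇝_ ∪ _⟶_) ⨾ ReflClosure _⊣⊢_ ⨾ (Star (_⇝_ ∪ _⟶_) ⁻¹)) →
    (_⊣⊢_ ⨾ _⟶_) ⇒ ((ReflClosure _⊣⊢_ ⨾ (Star (_⇝_ ∪ _⟶_) ⁻¹))
    ∪ (_⟶_ ⨾ Star (_⇝_ ∪ _⟶_) ⨾ ReflClosure _⊣⊢_ ⨾ (Star (_⇝_ ∪ _⟶_) ⁻¹))) →
    ChurchRosserModulo (Star _⊣⊢_) _⟶_
theorem2p2 _⊣⊢_ _⟶_ _⇝_ ⊣⊢-sym ⇝⊆⊣⊢ wf peaks cliffs =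
  Confluence.church-rosser _⊣⊢_ _⟶_ _⇝_ ⊣⊢-sym ⇝⊆⊣⊢ wf peaks cliffs
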